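{- For positive integers $p,q$, \[\sum_{c\ge1}c\binom{p+q}{p-c}p^{p-c}q^{q+c}=\frac{pq}{p+q}\binom{p+q}{q}p^pq^q.\]
   Context: Binomial coefficients $\binom{n}{k}$ with $k<0$ are $0$, so the sum is finite. -}

module Defs where

open import Data.Nat using (ℕ; zero; suc; _+_)

sum1to : ℕ → (ℕ → ℕ) → ℕ
sum1to zero    f = 0
sum1to (suc n) f = sum1to n f + f (suc n)

module Submission where

-- Write q = q' + 1, m = p + q - 1 and let t(c) be the summand
--   t(c) = c · C(p+q, p-c) · p^(p-c) · q^(q+c).
-- The sum telescopes against the "potential"
--   g(c) = C(m, q'+c) · p^(p+1-c) · q^(q+c),
-- that is t(c) + g(c+1) = g(c) for every 0 ≤ c ≤ p.  After dividing out
-- p^(p-c) · q^(q+c) this is the binomial identity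
--   c · C(m+1, k) + q · C(m, j+1) = p · C(m, j)      (k = p-c, j = q'+c),
-- which follows from Pascal's rule, the symmetry C(m+1,k) = C(m+1,j+1) and
-- the ratio rule (j+1) · C(m, j+1) = (m-j) · C(m, j).  Since t(0) = 0 and
-- g(p+1) = 0, summing gives Σ_{c=1}^{p} t(c) = g(0) = C(m, q') · p^(p+1) · q^q,
-- and the absorption identity (m+1) · C(m, q') = q · C(m+1, q) turns
-- (p+q) · g(0) into the right-hand side of the theorem.

open import Defs
open import Data.Nat using (ℕ; zero; suc; _+_; _*_; _∸_; _^_; _≤_; z≤n)
open import Data.Nat.Combinatorics
  using (_C_; nCk+nC[k+1]≡[n+1]C[k+1]; nCk≡nC[n∸k]; nC1≡n; k>n⇒nCk≡0)
open import Data.Nat.Properties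
open import Data.Nat.Tactic.RingSolver using (solve-∀)
open import Relation.Binary.PropositionalEquality

absorption : ∀ n k → suc n * (n C k) ≡ suc k * (suc n C suc k)
absorption zero    zero    = refl
absorption zero    (suc k) = sym (*-zeroʳ (suc (suc k)))
absorption (suc n) zero    =
  trans (*-identityʳ (suc (suc n))) (sym (trans (+-identityʳ _) (nC1≡n (suc (suc n)))))
absorption (suc n) (suc k) = sym (begin
    suc (suc k) * (suc (suc n) C suc (suc k))
  ≡⟨ cong (suc (suc k) *_) (sym (nCk+nC[k+1]≡[n+1]C[k+1] (suc n) (suc k))) ⟩
    suc (suc k) * (X + Y)
  ≡⟨ *-distribˡ-+ (suc (suc k)) X Y ⟩
    X + suc k * X + suc (suc k) * Y
  ≡⟨ cong₂ (λ u v → X + u + v) (sym (absorption n k)) (sym (absorption n (suc k))) ⟩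
    X + suc n * (n C k) + suc n * (n C suc k)
  ≡⟨ +-assoc X _ _ ⟩
    X + (suc n * (n C k) + suc n * (n C suc k))
  ≡⟨ cong (X +_) (sym (*-distribˡ-+ (suc n) (n C k) (n C suc k))) ⟩
    X + suc n * (n C k + n C suc k)
  ≡⟨ cong (λ z → X + suc n * z) (nCk+nC[k+1]≡[n+1]C[k+1] n k) ⟩
    suc (suc n) * X ∎)
  where
    open ≡-Reasoning
    X = suc n C suc k
    Y = suc n C suc (suc k)

-- Ratio of neighbouring binomials: (j+1) · C(j+r, j+1) = r · C(j+r, j).
-- Absorption and Pascal give (j+1)·(C(n,j) + C(n,j+1)) = (j+r+1)·C(n,j);
-- cancel (j+1)·C(n,j) on both sides.
ratio : ∀ j r → suc j * ((j + r) C suc j) ≡ r * ((j + r) C j)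
ratio j r = +-cancelʳ-≡ (suc j * B₀) _ _ (begin
    suc j * B₁ + suc j * B₀
  ≡⟨ sym (*-distribˡ-+ (suc j) B₁ B₀) ⟩
    suc j * (B₁ + B₀)
  ≡⟨ cong (suc j *_) (trans (+-comm B₁ B₀) (nCk+nC[k+1]≡[n+1]C[k+1] n j)) ⟩
    suc j * (suc n C suc j)
  ≡⟨ sym (absorption n j) ⟩
    suc (j + r) * B₀
  ≡⟨ split j r B₀ ⟩
    r * B₀ + suc j * B₀ ∎)
  where
    open ≡-Reasoning
    n  = j + r
    B₀ = n C j
    B₁ = n C suc j
    split : ∀ j r B → suc (j + r) * B ≡ r * B + suc j * B
    split = solve-∀

telescope : ∀ n (f g : ℕ → ℕ) → (∀ c → c ≤ n → f c + g (suc c) ≡ g c) →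
            f 0 + sum1to n f + g (suc n) ≡ g 0
telescope zero    f g step = trans (cong (_+ g 1) (+-identityʳ (f 0))) (step 0 z≤n)
telescope (suc n) f g step = begin
    f 0 + (sum1to n f + f (suc n)) + g (suc (suc n))
  ≡⟨ cong (_+ g (suc (suc n))) (sym (+-assoc (f 0) (sum1to n f) (f (suc n)))) ⟩
    f 0 + sum1to n f + f (suc n) + g (suc (suc n))
  ≡⟨ +-assoc (f 0 + sum1to n f) (f (suc n)) (g (suc (suc n))) ⟩
    f 0 + sum1to n f + (f (suc n) + g (suc (suc n)))
  ≡⟨ cong (f 0 + sum1to n f +_) (step (suc n) ≤-refl) ⟩
    f 0 + sum1to n f + g (suc n)
  ≡⟨ telescope n f g (λ c c≤n → step c (m≤n⇒m≤1+n c≤n)) ⟩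
    g 0 ∎
  where open ≡-Reasoning

-- Here C(p+q, k) = C(m+1, j+1) = C(m, j) + C(m, j+1), and q + c = j + 1,
-- so the ratio rule turns (j+1) · C(m, j+1) into k · C(m, j).
binomialStep : ∀ c k q' →
  let p = c + k
      q = suc q'
      m = q' + p
      j = q' + c
  in c * ((p + q) C k) + q * (m C suc j) ≡ p * (m C j)
binomialStep c k q' = begin
    c * ((p + q) C k) + q * B₁
  ≡⟨ cong (λ x → c * x + q * B₁) upperSymmetry ⟩
    c * (B₀ + B₁) + q * B₁
  ≡⟨ regroup c q' B₀ B₁ ⟩
    c * B₀ + suc (q' + c) * B₁
  ≡⟨ cong (c * B₀ +_) (subst (λ n → suc j * (n C suc j) ≡ k * (n C j)) (+-assoc q' c k) (ratio j k)) ⟩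
    c * B₀ + k * B₀
  ≡⟨ sym (*-distribʳ-+ B₀ c k) ⟩
    p * B₀ ∎
  where
    open ≡-Reasoning
    p  = c + k
    q  = suc q'
    m  = q' + p
    j  = q' + c
    B₀ = m C j
    B₁ = m C suc j
    size : p + q ≡ suc m
    size = trans (+-suc p q') (cong suc (+-comm p q'))
    upperAsSum : suc m ≡ suc j + k
    upperAsSum = cong suc (sym (+-assoc q' c k))
    upperSymmetry : (p + q) C k ≡ B₀ + B₁
    upperSymmetry = begin
        (p + q) C k
      ≡⟨ cong (_C k) size ⟩
        suc m C k
      ≡⟨ nCk≡nC[n∸k] (≤-trans (m≤n+m k (suc j)) (≤-reflexive (sym upperAsSum))) ⟩
        suc m C (suc m ∸ k)
      ≡⟨ cong (λ n → suc m C (n ∸ k)) upperAsSum ⟩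
        suc m C (suc j + k ∸ k)
      ≡⟨ cong (suc m C_) (m+n∸n≡m (suc j) k) ⟩
        suc m C suc j
      ≡⟨ sym (nCk+nC[k+1]≡[n+1]C[k+1] m j) ⟩
        B₀ + B₁ ∎
    regroup : ∀ c q' B₀ B₁ → c * (B₀ + B₁) + suc q' * B₁ ≡ c * B₀ + suc (q' + c) * B₁
    regroup = solve-∀

term : ℕ → ℕ → ℕ → ℕ
term p q c = c * ((p + q) C (p ∸ c)) * p ^ (p ∸ c) * q ^ (q + c)

potential : ℕ → ℕ → ℕ → ℕ
potential p q' c = ((q' + p) C (q' + c)) * p ^ (suc p ∸ c) * suc q' ^ (suc q' + c)

-- The telescoping step t(c) + g(c+1) = g(c), written with p = c + k.
-- Both sides share the factor p^k · q^(q+c); what is left is binomialStep.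
telescopingStep : ∀ c k q' →
  term (c + k) (suc q') c + potential (c + k) q' (suc c) ≡ potential (c + k) q' c
telescopingStep c k q' = begin
    term p q c + potential p q' (suc c)
  ≡⟨ cong₂ _+_ termShape nextShape ⟩
    c * B * P * Q + B₁ * P * (q * Q)
  ≡⟨ factorOut c B q B₁ P Q ⟩
    (c * B + q * B₁) * P * Q
  ≡⟨ cong (λ x → x * P * Q) (binomialStep c k q') ⟩
    p * B₀ * P * Q
  ≡⟨ reorder p B₀ P Q ⟩
    B₀ * (p * P) * Q
  ≡⟨ sym currentShape ⟩
    potential p q' c ∎
  where
    open ≡-Reasoning
    p  = c + k
    q  = suc q'
    m  = q' + p
    B  = (p + q) C k
    B₀ = m C (q' + c)
    B₁ = m C suc (q' + c)
    P  = p ^ k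
    Q  = q ^ (q + c)
    distance : p ∸ c ≡ k
    distance = m+n∸m≡n c k
    termShape : term p q c ≡ c * B * P * Q
    termShape = cong (λ x → c * ((p + q) C x) * p ^ x * Q) distance
    nextShape : potential p q' (suc c) ≡ B₁ * P * (q * Q)
    nextShape = trans (cong₂ (λ x y → (m C x) * p ^ (p ∸ c) * q ^ y) (+-suc q' c) (+-suc q c))
                      (cong (λ x → B₁ * p ^ x * (q * Q)) distance)
    currentShape : potential p q' c ≡ B₀ * (p * P) * Q
    currentShape = cong (λ x → B₀ * p ^ x * Q) (trans (+-∸-assoc 1 (m≤m+n c k)) (cong suc distance))
    factorOut : ∀ c B q B₁ P Q → c * B * P * Q + B₁ * P * (q * Q) ≡ (c * B + q * B₁) * P * Q
    factorOut = solve-∀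
    reorder : ∀ p B₀ P Q → p * B₀ * P * Q ≡ B₀ * (p * P) * Q
    reorder = solve-∀

potentialVanishes : ∀ p q' → potential p q' (suc p) ≡ 0
potentialVanishes p q' =
  cong (λ x → x * p ^ (p ∸ p) * suc q' ^ (suc q' + suc p))
       (k>n⇒nCk≡0 (+-monoʳ-< q' (n<1+n p)))

sumClosedForm : ∀ p q' → sum1to p (term p (suc q')) ≡ ((q' + p) C q') * p ^ suc p * suc q' ^ suc q'
sumClosedForm p q' = begin
    sum1to p (term p q)
  ≡⟨ sym (+-identityʳ _) ⟩
    sum1to p (term p q) + 0
  ≡⟨ cong (sum1to p (term p q) +_) (sym (potentialVanishes p q')) ⟩
    term p q 0 + sum1to p (term p q) + potential p q' (suc p)
  ≡⟨ telescope p (term p q) (potential p q') step ⟩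
    potential p q' 0
  ≡⟨ cong₂ (λ x y → ((q' + p) C x) * p ^ suc p * q ^ y) (+-identityʳ q') (+-identityʳ q) ⟩
    ((q' + p) C q') * p ^ suc p * q ^ q ∎
  where
    open ≡-Reasoning
    q = suc q'
    step : ∀ c → c ≤ p → term p q c + potential p q' (suc c) ≡ potential p q' c
    step c c≤p = subst (λ p → term p q c + potential p q' (suc c) ≡ potential p q' c)
                       (m+[n∸m]≡n c≤p) (telescopingStep c (p ∸ c) q')

lemma2p4 : (p' q' : ℕ) →
    let p = suc p'
        q = suc q'
    in (p + q) * sum1to p (λ c → c * ((p + q) C (p ∸ c)) * p ^ (p ∸ c) * q ^ (q + c))
         ≡ p * q * ((p + q) C q) * p ^ p * q ^ q
lemma2p4 p' q' = begin
    (p + q) * sum1to p (term p q)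
  ≡⟨ cong ((p + q) *_) (sumClosedForm p q') ⟩
    (p + q) * (B * (p * p ^ p) * q ^ q)
  ≡⟨ cong (λ n → n * (B * (p * p ^ p) * q ^ q)) (sym size) ⟩
    suc (q' + p) * (B * (p * p ^ p) * q ^ q)
  ≡⟨ regroup (suc (q' + p)) B p (p ^ p) (q ^ q) ⟩
    suc (q' + p) * B * p * p ^ p * q ^ q
  ≡⟨ cong (λ x → x * p * p ^ p * q ^ q) (absorption (q' + p) q') ⟩
    q * (suc (q' + p) C q) * p * p ^ p * q ^ q
  ≡⟨ cong (λ n → q * (n C q) * p * p ^ p * q ^ q) size ⟩
    q * ((p + q) C q) * p * p ^ p * q ^ q
  ≡⟨ reorder q ((p + q) C q) p (p ^ p) (q ^ q) ⟩
    p * q * ((p + q) C q) * p ^ p * q ^ q ∎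
  where
    open ≡-Reasoning
    p = suc p'
    q = suc q'
    B = (q' + p) C q'
    size : suc (q' + p) ≡ p + q
    size = trans (cong suc (+-comm q' p)) (sym (+-suc p q'))
    regroup : ∀ n B p P Q → n * (B * (p * P) * Q) ≡ n * B * p * P * Q
    regroup = solve-∀
    reorder : ∀ q C p P Q → q * C * p * P * Q ≡ p * q * C * P * Q
    reorder = solve-∀
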